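{- Every integer matrix $M\in\mathbb Z^{m\times n}$ can be brought, using only negations of rows and of columns, to a form in which every nonzero row and every nonzero column begins with a negative entry.
   Context: A vector $v$ begins with a negative entry if its first nonzero coordinate is negative. -}

module Defs where

open import Data.Nat using (ℕ)
open import Data.Integer using (ℤ; 0ℤ; _<_; -_)
open import Data.Fin using (Fin)
open import Data.List using (List; []; _∷_; tabulate)
open import Relation.Binary.PropositionalEquality using (_≡_)
open import Relation.Nullary using (¬_)

Matrix : ℕ → ℕ → Set
Matrix m n = Fin m → Fin n → ℤ

-- a list begins with a negative entry: its first nonzero entry is negative
data BeginsNegL : List ℤ → Set where
  here  : ∀ {x xs} → x < 0ℤ → BeginsNegL (x ∷ xs)
  there : ∀ {xs} → BeginsNegL xs → BeginsNegL (0ℤ ∷ xs)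

BeginsNeg : ∀ {n} → (Fin n → ℤ) → Set
BeginsNeg v = BeginsNegL (tabulate v)

IsZeroVec : ∀ {n} → (Fin n → ℤ) → Set
IsZeroVec v = ∀ j → v j ≡ 0ℤ

row : ∀ {m n} → Matrix m n → Fin m → (Fin n → ℤ)
row M i j = M i j

col : ∀ {m n} → Matrix m n → Fin n → (Fin m → ℤ)
col M j i = M i j

open import Data.Bool using (Bool; if_then_else_; _xor_)

negIf : Bool → ℤ → ℤ
negIf b x = if b then - x else x

negRowsCols : ∀ {m n} → (Fin m → Bool) → (Fin n → Bool) → Matrix m n → Matrix m n
negRowsCols r c M i j = negIf (r i) (negIf (c j) (M i j))

{-# OPTIONS --safe #-}
-- Induct on the number of rows, appending a last row R to a matrix whose
-- first m rows are already normalised by flags r′, c′.  Columns that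
-- are nonzero above keep their leading entry and their flag.  A column that is
-- zero above has its leading entry in R, and its flag is still free: it is
-- chosen to make that entry negative, whatever the flag b of the new row is.
-- Finally b is chosen to make the leading entry of R negative; if that entry
-- lies in a free column, the column flag has already taken care of it.
module Submission where

open import Defs
open import Data.Nat using (ℕ; zero; suc)
open import Data.Bool using (Bool; true; false; if_then_else_; _xor_)
open import Data.Bool.Properties using (not-involutive; xor-comm)
open import Data.Fin using (Fin; Fin′; inject; inject₁; fromℕ; zero; suc)
open import Data.Fin.Properties using (all?; ¬∀⟶∃¬-smallest)
open import Data.Fin.Relation.Unary.Top using (View; view; ‵fromℕ; ‵inject₁; view-inject₁; view-fromℕ)
open import Data.Integer using (ℤ; +0; +[1+_]; -[1+_]; 0ℤ; _<_; -<+; _≟_)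
open import Data.Integer.Properties using (neg-involutive)
open import Data.List using ([]; _∷_; _++_; _∷ʳ_; tabulate)
open import Data.List.Properties using (tabulate-cong)
open import Data.List.Relation.Unary.All using (All; []; _∷_)
open import Data.List.Relation.Unary.All.Properties using (tabulate⁺)
open import Data.Product using (Σ; ∃-syntax; _×_; _,_; proj₁; proj₂)
open import Data.Vec.Functional using (init; last)
open import Function using (_∘_)
open import Relation.Binary.PropositionalEquality
  using (_≡_; _≢_; _≗_; refl; sym; trans; cong; cong₂; subst)
open import Relation.Nullary using (¬_; Dec; yes; no; does; contradiction)
open import Relation.Nullary.Decidable using (dec-true; dec-false)

private
  variable
    A : Set
    m n : ℕ

isPos : ℤ → Bool
isPos +[1+ _ ] = true
isPos _        = false

negIf-xor : ∀ b c x → negIf b (negIf c x) ≡ negIf (b xor c) x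
negIf-xor true  true  x = neg-involutive x
negIf-xor true  false x = refl
negIf-xor false c     x = refl

negIf-0 : ∀ b → negIf b 0ℤ ≡ 0ℤ
negIf-0 true  = refl
negIf-0 false = refl

negIf≡0⇒≡0 : ∀ b {x} → negIf b x ≡ 0ℤ → x ≡ 0ℤ
negIf≡0⇒≡0 false              eq = eq
negIf≡0⇒≡0 true  {+0}         _  = refl
negIf≡0⇒≡0 true  {+[1+ _ ]}   ()
negIf≡0⇒≡0 true  { -[1+ _ ] } ()

negIf-isPos<0 : ∀ {x} → x ≢ 0ℤ → negIf (isPos x) x < 0ℤ
negIf-isPos<0 {+0}       x≢0 = contradiction refl x≢0
negIf-isPos<0 {+[1+ _ ]} _   = -<+
negIf-isPos<0 { -[1+ _ ]} _  = -<+

xor-cancelˡ : ∀ b c → b xor (b xor c) ≡ c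
xor-cancelˡ true  c = not-involutive c
xor-cancelˡ false c = refl

negRowsCols-entry : ∀ r c (M : Matrix m n) i j →
                    negRowsCols r c M i j ≡ negIf (r i xor c j) (M i j)
negRowsCols-entry r c M i j = negIf-xor (r i) (c j) (M i j)

negRowsCols-0 : ∀ r c (M : Matrix m n) {i j} → M i j ≡ 0ℤ → negRowsCols r c M i j ≡ 0ℤ
negRowsCols-0 r c M {i} {j} eq =
  trans (negRowsCols-entry r c M i j) (trans (cong (negIf (r i xor c j)) eq) (negIf-0 _))

negRowsCols≡0⇒≡0 : ∀ r c (M : Matrix m n) {i j} → negRowsCols r c M i j ≡ 0ℤ → M i j ≡ 0ℤ
negRowsCols≡0⇒≡0 r c M {i} {j} = negIf≡0⇒≡0 (c j) ∘ negIf≡0⇒≡0 (r i)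

beginsNegL-++ : ∀ {xs} ys → BeginsNegL xs → BeginsNegL (xs ++ ys)
beginsNegL-++ ys (here x<0) = here x<0
beginsNegL-++ ys (there p)  = there (beginsNegL-++ ys p)

beginsNegL-zeros-++ : ∀ {xs ys} → All (_≡ 0ℤ) xs → BeginsNegL ys → BeginsNegL (xs ++ ys)
beginsNegL-zeros-++ []           p = p
beginsNegL-zeros-++ (refl ∷ zs) p = there (beginsNegL-zeros-++ zs p)

beginsNeg-cong : {v w : Fin n → ℤ} → v ≗ w → BeginsNeg w → BeginsNeg v
beginsNeg-cong v≗w = subst BeginsNegL (sym (tabulate-cong v≗w))

FirstNonzeroAt : (Fin n → ℤ) → Fin n → Set
FirstNonzeroAt v i = v i ≢ 0ℤ × ((j : Fin′ i) → v (inject j) ≡ 0ℤ)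

beginsNeg-at : (v : Fin n → ℤ) (i : Fin n) → v i < 0ℤ →
               ((j : Fin′ i) → v (inject j) ≡ 0ℤ) → BeginsNeg v
beginsNeg-at v zero    vᵢ<0 _      = here vᵢ<0
beginsNeg-at v (suc i) vᵢ<0 before rewrite before zero =
  there (beginsNeg-at (v ∘ suc) i vᵢ<0 (before ∘ suc))

beginsNeg-negIf : {v : Fin n → ℤ} {i : Fin n} (d : Fin n → Bool) →
                  FirstNonzeroAt v i → d i ≡ isPos (v i) →
                  BeginsNeg (λ j → negIf (d j) (v j))
beginsNeg-negIf {v = v} {i} d (vᵢ≢0 , before) dᵢ≡ =
  beginsNeg-at _ i
    (subst (λ b → negIf b (v i) < 0ℤ) (sym dᵢ≡) (negIf-isPos<0 vᵢ≢0))
    (λ j → trans (cong (negIf (d (inject j))) (before j)) (negIf-0 _))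

tabulate-init-last : (f : Fin (suc n) → A) → tabulate f ≡ tabulate (init f) ∷ʳ last f
tabulate-init-last {n = zero}  f = refl
tabulate-init-last {n = suc n} f = cong (f zero ∷_) (tabulate-init-last (f ∘ suc))

beginsNeg-init : (v : Fin (suc n) → ℤ) → BeginsNeg (init v) → BeginsNeg v
beginsNeg-init v p =
  subst BeginsNegL (sym (tabulate-init-last v)) (beginsNegL-++ (last v ∷ []) p)

beginsNeg-last : (v : Fin (suc n) → ℤ) → IsZeroVec (init v) → last v < 0ℤ → BeginsNeg v
beginsNeg-last v zeros neg =
  subst BeginsNegL (sym (tabulate-init-last v)) (beginsNegL-zeros-++ (tabulate⁺ zeros) (here neg))

isZeroVec-init-last : (v : Fin (suc n) → ℤ) → IsZeroVec (init v) → last v ≡ 0ℤ → IsZeroVec v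
isZeroVec-init-last v zeros lastZero i with view i
... | ‵fromℕ      = lastZero
... | ‵inject₁ i′ = zeros i′

snoc : (Fin m → A) → A → Fin (suc m) → A
snoc f a i with view i
... | ‵fromℕ      = a
... | ‵inject₁ i′ = f i′

snoc-inject₁ : (f : Fin m → A) (a : A) (i : Fin m) → snoc f a (inject₁ i) ≡ f i
snoc-inject₁ f a i rewrite view-inject₁ i = refl

snoc-fromℕ : (f : Fin m → A) (a : A) → snoc f a (fromℕ m) ≡ a
snoc-fromℕ {m = m} f a rewrite view-fromℕ m = refl

SignNormal : Matrix m n → Set
SignNormal N = ((i : _) → ¬ IsZeroVec (row N i) → BeginsNeg (row N i))
             × ((j : _) → ¬ IsZeroVec (col N j) → BeginsNeg (col N j))

SignNormalisable : Matrix m n → Set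
SignNormalisable {m} {n} M =
  Σ (Fin m → Bool) λ r → Σ (Fin n → Bool) λ c → SignNormal (negRowsCols r c M)

module LastRow (M : Matrix (suc m) n) (r′ : Fin m → Bool) (c′ : Fin n → Bool)
               (normal′ : SignNormal (negRowsCols r′ c′ (init M))) (b : Bool)
               (aligned : ¬ IsZeroVec (last M) →
                          ∃[ j₀ ] FirstNonzeroAt (last M) j₀ × b xor c′ j₀ ≡ isPos (last M j₀))
               where

  R : Fin n → ℤ
  R = last M

  N′ : Matrix m n
  N′ = negRowsCols r′ c′ (init M)

  Free : Fin n → Set
  Free j = IsZeroVec (col (init M) j)

  free? : ∀ j → Dec (Free j)
  free? j = all? (λ i → M (inject₁ i) j ≟ 0ℤ)

  r : Fin (suc m) → Bool
  r = snoc r′ b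

  c : Fin n → Bool
  c j = if does (free? j) then b xor isPos (R j) else c′ j

  N : Matrix (suc m) n
  N = negRowsCols r c M

  c-free : ∀ {j} → Free j → c j ≡ b xor isPos (R j)
  c-free {j} free = cong (if_then b xor isPos (R j) else c′ j) (dec-true (free? j) free)

  c-nonfree : ∀ {j} → ¬ Free j → c j ≡ c′ j
  c-nonfree {j} ¬free = cong (if_then b xor isPos (R j) else c′ j) (dec-false (free? j) ¬free)

  lastFlag-free : ∀ {j} → Free j → b xor c j ≡ isPos (R j)
  lastFlag-free {j} free = trans (cong (b xor_) (c-free free)) (xor-cancelˡ b (isPos (R j)))

  N-upper : ∀ i j → N (inject₁ i) j ≡ N′ i j
  N-upper i j with free? j
  ... | yes free  = trans (negRowsCols-0 r c M (free i)) (sym (negRowsCols-0 r′ c′ (init M) (free i)))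
  ... | no ¬free = cong₂ (λ s t → negIf s (negIf t (M (inject₁ i) j)))
                         (snoc-inject₁ r′ b i) (c-nonfree ¬free)

  N-last : ∀ j → N (fromℕ m) j ≡ negIf (b xor c j) (R j)
  N-last j = trans (negRowsCols-entry r c M (fromℕ m) j)
                   (cong (λ s → negIf (s xor c j) (R j)) (snoc-fromℕ r′ b))

  upperRow : ∀ i → ¬ IsZeroVec (row N (inject₁ i)) → BeginsNeg (row N (inject₁ i))
  upperRow i nonzero = beginsNeg-cong (N-upper i)
    (proj₁ normal′ i (λ zero′ → nonzero (λ j → trans (N-upper i j) (zero′ j))))

  lastRow : ¬ IsZeroVec (row N (fromℕ m)) → BeginsNeg (row N (fromℕ m))
  lastRow nonzero with aligned (λ R≡0 → nonzero (λ j → negRowsCols-0 r c M (R≡0 j)))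
  ... | j₀ , first , b⊕c′≡ = beginsNeg-cong N-last (beginsNeg-negIf (λ j → b xor c j) first flag)
    where
    flag : b xor c j₀ ≡ isPos (R j₀)
    flag with free? j₀
    ... | yes free  = lastFlag-free free
    ... | no ¬free = trans (cong (b xor_) (c-nonfree ¬free)) b⊕c′≡

  rows : ∀ i → ¬ IsZeroVec (row N i) → BeginsNeg (row N i)
  rows i = byView (view i)
    where
    byView : ∀ {i} → View i → ¬ IsZeroVec (row N i) → BeginsNeg (row N i)
    byView ‵fromℕ        = lastRow
    byView (‵inject₁ i′) = upperRow i′

  columns : ∀ j → ¬ IsZeroVec (col N j) → BeginsNeg (col N j)
  columns j nonzero with free? j
  ... | yes free  = beginsNeg-last (col N j) upperZero (subst (_< 0ℤ) (sym lastEq) (negIf-isPos<0 Rⱼ≢0))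
    where
    upperZero : IsZeroVec (init (col N j))
    upperZero i = negRowsCols-0 r c M (free i)
    lastEq : N (fromℕ m) j ≡ negIf (isPos (R j)) (R j)
    lastEq = trans (N-last j) (cong (λ s → negIf s (R j)) (lastFlag-free free))
    Rⱼ≢0 : R j ≢ 0ℤ
    Rⱼ≢0 Rⱼ≡0 = nonzero (isZeroVec-init-last (col N j) upperZero (negRowsCols-0 r c M Rⱼ≡0))
  ... | no ¬free = beginsNeg-init (col N j) (beginsNeg-cong (λ i → N-upper i j) (proj₂ normal′ j col′≢0))
    where
    col′≢0 : ¬ IsZeroVec (col N′ j)
    col′≢0 zero′ = ¬free (λ i → negRowsCols≡0⇒≡0 r′ c′ (init M) (zero′ i))

  signNormalisable : SignNormalisable M
  signNormalisable = r , c , rows , columns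

extend : (M : Matrix (suc m) n) → SignNormalisable (init M) → SignNormalisable M
extend {n = n} M (r′ , c′ , normal′) with all? (λ j → last M j ≟ 0ℤ)
... | yes R≡0 = LastRow.signNormalisable M r′ c′ normal′ false (contradiction R≡0)
... | no R≢0  with ¬∀⟶∃¬-smallest n _ (λ j → last M j ≟ 0ℤ) R≢0
...   | j₀ , first = LastRow.signNormalisable M r′ c′ normal′ (c′ j₀ xor isPos (last M j₀))
                       (λ _ → j₀ , first , trans (xor-comm _ (c′ j₀)) (xor-cancelˡ (c′ j₀) _))

theorem3p3 : (m n : ℕ) → (M : Matrix m n) →
    Σ (Fin m → Bool) λ r → Σ (Fin n → Bool) λ c →
      ((i : Fin m) → ¬ IsZeroVec (row (negRowsCols r c M) i) → BeginsNeg (row (negRowsCols r c M) i))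
      × ((j : Fin n) → ¬ IsZeroVec (col (negRowsCols r c M) j) → BeginsNeg (col (negRowsCols r c M) j))
theorem3p3 zero    n M = (λ ()) , (λ _ → false) , (λ ()) , λ j nonzero → contradiction (λ ()) nonzero
theorem3p3 (suc m) n M = extend M (theorem3p3 m n (init M))
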